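{- Let $k\ge1$ be an integer and let $G$ be a connected graph with $n=|V(G)|$ vertices that has a matching of size $k$ (so $n\ge 2k$). Let $\mathcal{P}_k(G)$ be the convex hull of all $x\in\{0,1\}^{V(G)\times[k]}$ satisfying (a) $\sum_{v\in V(G)} x_{v,i}\le \sum_{v\in V(G)} x_{v,i+1}$ for all $i\in[k-1]$; (b) $\sum_{i\in[k]} x_{v,i}\le 1$ for all $v\in V(G)$; (c) $x_{u,i}+x_{v,i}-\sum_{z\in S}x_{z,i}\le 1$ for every pair of distinct non-adjacent vertices $u,v$, every minimal $(u,v)$-separator $S$, and every $i\in[k]$. Then for every $v\in V(G)$ and $i\in[k]$, the inequality $x_{v,i}\ge 0$ induces a facet of $\mathcal{P}_k(G)$.
   Context: $[k]=\{1,\dots,k\}$. For non-adjacent vertices $u,v$, a $(u,v)$-separator is a set $S\subseteq V(G)\setminus\{u,v\}$ such that $u,v$ are in different components of $G-S$; minimal means inclusion-minimal. A valid inequality induces a facet if the face $\{x\in\mathcal{P}_k(G)\colon \text{equality holds}\}$ has dimension $\dim\mathcal{P}_k(G)-1$.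
   Formalization: The polytope $\mathcal{P}_k(G)$ is taken as the set of its rational points, with convex combinations, affine independence and dimension all taken over ℚ. -}

module Defs where

open import Data.Nat as ℕ using (ℕ; zero; suc)
open import Data.Fin using (Fin; zero; suc; toℕ)
open import Data.Bool using (Bool; true; false; if_then_else_)
open import Data.Rational as ℚ using (ℚ; 0ℚ; 1ℚ)
open import Data.Product using (Σ; ∃; ∃-syntax; _×_; _,_)
open import Data.Sum using (_⊎_)
open import Relation.Binary.PropositionalEquality using (_≡_; _≢_)
open import Relation.Nullary using (¬_)

Σℕ : ∀ {m} → (Fin m → ℕ) → ℕ
Σℕ {zero}  f = 0
Σℕ {suc m} f = f zero ℕ.+ Σℕ (λ j → f (suc j))

Σℚ : ∀ {m} → (Fin m → ℚ) → ℚ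
Σℚ {zero}  f = 0ℚ
Σℚ {suc m} f = f zero ℚ.+ Σℚ (λ j → f (suc j))

b2ℕ : Bool → ℕ
b2ℕ true  = 1
b2ℕ false = 0

b2ℚ : Bool → ℚ
b2ℚ true  = 1ℚ
b2ℚ false = 0ℚ

record Graph (n : ℕ) : Set where
  field
    adj  : Fin n → Fin n → Bool
    sym  : ∀ u v → adj u v ≡ adj v u
    irr  : ∀ v → adj v v ≡ false
open Graph public

VSet : ℕ → Set
VSet n = Fin n → Bool

data WalkAvoid {n} (G : Graph n) (S : VSet n) : Fin n → Fin n → Set where
  here : ∀ {u} → S u ≡ false → WalkAvoid G S u u
  step : ∀ {u w v} → S u ≡ false → adj G u w ≡ true →
         WalkAvoid G S w v → WalkAvoid G S u v

Connected : ∀ {n} → Graph n → Set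
Connected {n} G = ∀ (u v : Fin n) → WalkAvoid G (λ _ → false) u v

HasMatching : ∀ {n} → Graph n → ℕ → Set
HasMatching {n} G k =
  Σ (Fin k → Fin n) λ a → Σ (Fin k → Fin n) λ b →
    (∀ j → adj G (a j) (b j) ≡ true) ×
    (∀ j j' → j ≢ j' → (a j ≢ a j') × (a j ≢ b j') × (b j ≢ b j'))

IsSeparator : ∀ {n} → Graph n → Fin n → Fin n → VSet n → Set
IsSeparator G u v S = (S u ≡ false) × (S v ≡ false) × ¬ WalkAvoid G S u v

_⊆_ : ∀ {n} → VSet n → VSet n → Set
A ⊆ B = ∀ z → A z ≡ true → B z ≡ true

IsMinSeparator : ∀ {n} → Graph n → Fin n → Fin n → VSet n → Set
IsMinSeparator G u v S =
  IsSeparator G u v S ×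
  (∀ S' → S' ⊆ S → IsSeparator G u v S' → S ⊆ S')

BinPoint : ℕ → ℕ → Set
BinPoint n k = Fin n → Fin k → Bool

Feasible : ∀ {n} → Graph n → (k : ℕ) → BinPoint n k → Set
Feasible {n} G k x =
  (∀ (i i' : Fin k) → toℕ i' ≡ suc (toℕ i) →
     Σℕ (λ v → b2ℕ (x v i)) ℕ.≤ Σℕ (λ v → b2ℕ (x v i'))) ×
  (∀ v → Σℕ (λ i → b2ℕ (x v i)) ℕ.≤ 1) ×
  (∀ (u v : Fin n) → u ≢ v → adj G u v ≡ false →
     ∀ S → IsMinSeparator G u v S → ∀ (i : Fin k) →
       b2ℕ (x u i) ℕ.+ b2ℕ (x v i) ℕ.≤ 1 ℕ.+ Σℕ (λ z → if S z then b2ℕ (x z i) else 0))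

Point : ℕ → ℕ → Set
Point n k = Fin n → Fin k → ℚ

embed : ∀ {n k} → BinPoint n k → Point n k
embed x v i = b2ℚ (x v i)

InPk : ∀ {n} → Graph n → (k : ℕ) → Point n k → Set
InPk {n} G k y =
  ∃[ m ] Σ (Fin m → BinPoint n k) λ p → Σ (Fin m → ℚ) λ λs →
    (∀ j → Feasible G k (p j)) × (∀ j → 0ℚ ℚ.≤ λs j) × (Σℚ λs ≡ 1ℚ) ×
    (∀ v i → y v i ≡ Σℚ (λ j → λs j ℚ.* embed (p j) v i))

AffIndep : ∀ {n k m} → (Fin m → Point n k) → Set
AffIndep {n} {k} {m} q =
  ∀ (c : Fin m → ℚ) → Σℚ c ≡ 0ℚ →
    (∀ v i → Σℚ (λ j → c j ℚ.* q j v i) ≡ 0ℚ) → ∀ j → c j ≡ 0ℚ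

HasDim : ∀ {n k} → (Point n k → Set) → ℕ → Set
HasDim {n} {k} A d =
  (Σ (Fin (suc d) → Point n k) λ q → (∀ j → A (q j)) × AffIndep q) ×
  (∀ (q : Fin (suc (suc d)) → Point n k) → (∀ j → A (q j)) → ¬ AffIndep q)

Empty : ∀ {n k} → (Point n k → Set) → Set
Empty A = ∀ y → ¬ A y

InducesFacet : ∀ {n k} → (Point n k → Set) → (Point n k → ℚ) → Set
InducesFacet A a =
  (∀ y → A y → 0ℚ ℚ.≤ a y) ×
  ((∃[ d ] HasDim A (suc d) × HasDim (λ y → A y × (a y ≡ 0ℚ)) d) ⊎
   (HasDim A 0 × Empty (λ y → A y × (a y ≡ 0ℚ))))

-- Fix an injection e : [k] → V(G) avoiding v; it exists because the matching forces n > k.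
-- For each coordinate (u, i) take the 0/1 point whose colour classes below i are empty and whose
-- class j ≥ i is {τ (e j)}, τ the transposition of u and e i; so class i is {u}.
-- Ordered by colour these points form a unitriangular system, so with the origin they give n·k + 1
-- affinely independent points of P_k(G); dropping the point for (v, i), the others lie on
-- x_{v,i} = 0 (this is where e avoids v).  The upper bounds are Gaussian elimination: more than
-- D + 1 points supported on D coordinates are affinely dependent.

module Submission where

open import Defs hiding (sym)
open import Data.Nat as ℕ using (ℕ; zero; suc; s≤s; z≤n; _≥_)
import Data.Nat.Properties as NP
open import Data.Bool as Bool using (Bool; true; false)
open import Data.Bool.Properties using (¬-not)
open import Data.Empty using (⊥)
open import Data.Fin as F using (Fin; zero; suc; toℕ; punchIn; punchOut)
import Data.Fin.Properties as FP
open import Data.Fin.Permutation.Components using (transpose; transpose-inverse)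
open import Data.Rational as ℚ using (ℚ; 0ℚ; 1ℚ; _+_; _*_; -_; _-_)
import Data.Rational.Properties as QP
open import Data.Rational.Solver using (module +-*-Solver)
open +-*-Solver using (solve; _:+_; _:*_; :-_; _:-_; _:=_; con)
open import Data.Product using (∃; _×_; _,_; proj₁; proj₂; uncurry)
open import Data.Sum using (_⊎_; inj₁; inj₂)
open import Data.Vec.Functional using (_∷_; insertAt)
open import Data.Vec.Functional.Properties using (insertAt-lookup; insertAt-punchIn)
open import Function using (_∘_; Injective)
open import Relation.Binary.PropositionalEquality
open import Relation.Nullary using (¬_; ¬?; Dec; yes; no; does; contradiction; _×-dec_)
open import Relation.Nullary.Decidable using (dec-true; dec-false; decidable-stable)
open import Algebra.Bundles using (Ring)
open import Algebra.Properties.Semiring.Sum (Ring.semiring QP.+-*-ring)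
  using (sum; sum-cong-≗; sum-replicate-zero; sum-remove; ∑-distrib-+; *-distribʳ-sum)
open import Algebra.Apartness.Properties.HeytingCommutativeRing QP.heytingCommutativeRing
  using (x#0y#0→xy#0)

Σℚ≡sum : ∀ {m} (f : Fin m → ℚ) → Σℚ f ≡ sum f
Σℚ≡sum {zero}  f = refl
Σℚ≡sum {suc m} f = cong (f zero +_) (Σℚ≡sum (λ j → f (suc j)))

sum-zero : ∀ {m} {f : Fin m → ℚ} → (∀ j → f j ≡ 0ℚ) → sum f ≡ 0ℚ
sum-zero {m} f≡0 = trans (sum-cong-≗ f≡0) (sum-replicate-zero m)

*-vanishʳ : ∀ x {y} → y ≡ 0ℚ → x * y ≡ 0ℚ
*-vanishʳ x refl = QP.*-zeroʳ x

*-vanishˡ : ∀ {x} y → x ≡ 0ℚ → x * y ≡ 0ℚ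
*-vanishˡ y refl = QP.*-zeroˡ y

sum-single : ∀ {m} (f : Fin m → ℚ) (p : Fin m) → (∀ j → j ≢ p → f j ≡ 0ℚ) → sum f ≡ f p
sum-single {suc m} f p f≡0 = begin
  sum f                      ≡⟨ sum-remove {i = p} f ⟩
  f p + sum (f ∘ punchIn p)  ≡⟨ cong (f p +_) (sum-zero (λ j → f≡0 (punchIn p j) (FP.punchInᵢ≢i p j))) ⟩
  f p + 0ℚ                   ≡⟨ QP.+-identityʳ (f p) ⟩
  f p                        ∎
  where open ≡-Reasoning

LinearlyDependent : ∀ {N D} → (Fin N → Fin D → ℚ) → Set
LinearlyDependent {N} q =
  ∃ λ (c : Fin N → ℚ) → (∃ λ j → c j ≢ 0ℚ) × (∀ d → sum (λ j → c j * q j d) ≡ 0ℚ)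

dependent-tail : ∀ {N D} (q : Fin N → Fin (suc D) → ℚ) → (∀ j → q j zero ≡ 0ℚ) →
  LinearlyDependent (λ j d → q j (suc d)) → LinearlyDependent q
dependent-tail q q₀≡0 (c , nonzero , c·q≡0) = c , nonzero , λ
  { zero    → sum-zero (λ j → *-vanishʳ (c j) (q₀≡0 j))
  ; (suc d) → c·q≡0 d }

module Pivot {N D} (q : Fin (suc N) → Fin D → ℚ) (j₀ : Fin (suc N)) (a : ℚ) (b : Fin N → ℚ) where

  eliminate : Fin N → Fin D → ℚ
  eliminate j d = a * q (punchIn j₀ j) d - b j * q j₀ d

  lift : (Fin N → ℚ) → Fin (suc N) → ℚ
  lift c′ = insertAt (λ j → a * c′ j) j₀ (- sum (λ j → c′ j * b j))

  lift-combination : ∀ c′ d → sum (λ j → lift c′ j * q j d) ≡ sum (λ j → c′ j * eliminate j d)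
  lift-combination c′ d = begin
    sum (λ j → lift c′ j * q j d)
      ≡⟨ sum-remove {i = j₀} (λ j → lift c′ j * q j d) ⟩
    lift c′ j₀ * x + sum (λ j → lift c′ (punchIn j₀ j) * y j)
      ≡⟨ cong₂ _+_ (cong (_* x) (insertAt-lookup _ j₀ _))
                   (sum-cong-≗ (λ j → cong (_* y j) (insertAt-punchIn _ j₀ _ j))) ⟩
    - S * x + sum (λ j → (a * c′ j) * y j)
      ≡⟨ cong (_+ sum (λ j → (a * c′ j) * y j)) (begin
           - S * x                           ≡⟨ solve 2 (λ s x → :- s :* x := s :* (:- x)) refl S x ⟩
           S * (- x)                         ≡⟨ *-distribʳ-sum (- x) (λ j → c′ j * b j) ⟩
           sum (λ j → (c′ j * b j) * (- x))  ∎) ⟩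
    sum (λ j → (c′ j * b j) * (- x)) + sum (λ j → (a * c′ j) * y j)
      ≡⟨ sym (∑-distrib-+ (λ j → (c′ j * b j) * (- x)) (λ j → (a * c′ j) * y j)) ⟩
    sum (λ j → (c′ j * b j) * (- x) + (a * c′ j) * y j)
      ≡⟨ sum-cong-≗ (λ j → solve 5 (λ γ β ξ α η → (γ :* β) :* (:- ξ) :+ (α :* γ) :* η := γ :* (α :* η :- β :* ξ))
                                   refl (c′ j) (b j) x a (y j)) ⟩
    sum (λ j → c′ j * eliminate j d) ∎
    where
    open ≡-Reasoning
    x : ℚ
    x = q j₀ d
    y : Fin N → ℚ
    y j = q (punchIn j₀ j) d
    S : ℚ
    S = sum (λ j → c′ j * b j)

  dependent-lift : a ≢ 0ℚ → LinearlyDependent eliminate → LinearlyDependent q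
  dependent-lift a≢0 (c′ , (j , c′ⱼ≢0) , c′·r≡0) =
    lift c′ ,
    (punchIn j₀ j , λ eq → x#0y#0→xy#0 a≢0 c′ⱼ≢0 (trans (sym (insertAt-punchIn _ j₀ _ j)) eq)) ,
    λ d → trans (lift-combination c′ d) (c′·r≡0 d)

linearlyDependent : ∀ {N D} → D ℕ.< N → (q : Fin N → Fin D → ℚ) → LinearlyDependent q
linearlyDependent {suc N} {zero} _ q = (λ _ → 1ℚ) , (zero , λ ()) , λ ()
linearlyDependent {suc N} {suc D} (s≤s D<N) q with FP.any? (λ j → ¬? (q j zero QP.≟ 0ℚ))
... | no ∄pivot =
  dependent-tail q column₀≡0 (linearlyDependent (NP.m<n⇒m<1+n D<N) (λ j d → q j (suc d)))
  where
  column₀≡0 : ∀ j → q j zero ≡ 0ℚ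
  column₀≡0 j = decidable-stable (q j zero QP.≟ 0ℚ) (λ q≢0 → ∄pivot (j , q≢0))
... | yes (j₀ , pivot≢0) =
  dependent-lift pivot≢0
    (dependent-tail eliminate eliminated (linearlyDependent D<N (λ j d → eliminate j (suc d))))
  where
  b : Fin N → ℚ
  b j = q (punchIn j₀ j) zero
  open Pivot q j₀ (q j₀ zero) b
  eliminated : ∀ j → eliminate j zero ≡ 0ℚ
  eliminated j = solve 2 (λ x y → x :* y :- y :* x := con 0ℚ) refl (q j₀ zero) (b j)

Coord : ℕ → ℕ → Set
Coord n k = Fin n × Fin k

_at_ : ∀ {n k} → Point n k → Coord n k → ℚ
y at c = y (proj₁ c) (proj₂ c)

0ᵖ : ∀ {n k} → Point n k
0ᵖ _ _ = 0ℚ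

SupportedOn : ∀ {n k D} → (Fin D → Coord n k) → (Point n k → Set) → Set
SupportedOn σ A = ∀ c → (∃ λ d → σ d ≡ c) ⊎ (∀ y → A y → y at c ≡ 0ℚ)

supportedOn-removeAt : ∀ {n k D} {σ : Fin (suc D) → Coord n k} {A : Point n k → Set} (p : Fin (suc D)) →
  SupportedOn σ A → (∀ y → A y → y at σ p ≡ 0ℚ) → SupportedOn (σ ∘ punchIn p) A
supportedOn-removeAt {σ = σ} p supp vanish c with supp c
... | inj₂ zero-at-c = inj₂ zero-at-c
... | inj₁ (d , σd≡c) with d FP.≟ p
...   | yes refl = inj₂ (λ y Ay → trans (cong (y at_) (sym σd≡c)) (vanish y Ay))
...   | no d≢p  = inj₁ (punchOut (d≢p ∘ sym) , trans (cong σ (FP.punchIn-punchOut (d≢p ∘ sym))) σd≡c)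

remQuot-injective : ∀ {n} k → Injective _≡_ _≡_ (F.remQuot {n} k)
remQuot-injective {n} k {a} {b} eq = begin
  a                                      ≡⟨ sym (FP.combine-remQuot {n} k a) ⟩
  uncurry F.combine (F.remQuot {n} k a)  ≡⟨ cong (uncurry F.combine) eq ⟩
  uncurry F.combine (F.remQuot {n} k b)  ≡⟨ FP.combine-remQuot {n} k b ⟩
  b                                      ∎
  where open ≡-Reasoning

supportedOn-remQuot : ∀ {n k} {A : Point n k → Set} → SupportedOn (F.remQuot {n} k) A
supportedOn-remQuot (v , i) = inj₁ (F.combine v i , FP.remQuot-combine v i)

¬affIndep-supportedOn : ∀ {n k D N} {σ : Fin D → Coord n k} {A : Point n k → Set} →
  SupportedOn σ A → suc D ℕ.< N → (q : Fin N → Point n k) → (∀ j → A (q j)) → ¬ AffIndep q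
¬affIndep-supportedOn {σ = σ} supp D+1<N q Aq affIndep
  with linearlyDependent D+1<N (λ j → 1ℚ ∷ λ d → q j at σ d)
... | c , (j , cⱼ≢0) , c·q≡0 = cⱼ≢0 (affIndep c Σc≡0 Σcq≡0 j)
  where
  Σc≡0 : Σℚ c ≡ 0ℚ
  Σc≡0 = trans (Σℚ≡sum c) (trans (sum-cong-≗ (λ j → sym (QP.*-identityʳ (c j)))) (c·q≡0 zero))
  Σcq≡0 : ∀ v i → Σℚ (λ j → c j * q j v i) ≡ 0ℚ
  Σcq≡0 v i with supp (v , i)
  ... | inj₁ (d , refl) = trans (Σℚ≡sum (λ j → c j * q j v i)) (c·q≡0 (suc d))
  ... | inj₂ zero-at =
    trans (Σℚ≡sum (λ j → c j * q j v i)) (sum-zero (λ j → *-vanishʳ (c j) (zero-at (q j) (Aq j))))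

record Unitriangular {n k D}
  (σ : Fin D → Coord n k) (rank : Fin D → ℕ) (q : Fin D → Point n k) : Set where
  field
    diagonal     : ∀ j → q j at σ j ≡ 1ℚ
    off-diagonal : ∀ j j′ → j′ ≢ j → rank j ℕ.≤ rank j′ → q j′ at σ j ≡ 0ℚ

linearIndependent-unitriangular :
  ∀ {n k D} {σ : Fin D → Coord n k} {rank : Fin D → ℕ} {q : Fin D → Point n k} → Unitriangular σ rank q →
  (c : Fin D → ℚ) → (∀ j → sum (λ j′ → c j′ * (q j′ at σ j)) ≡ 0ℚ) → ∀ j → c j ≡ 0ℚ
linearIndependent-unitriangular {σ = σ} {rank} {q} tri c c·q≡0 j = below (suc (rank j)) j NP.≤-refl
  where
  open Unitriangular tri
  below : ∀ r j → rank j ℕ.< r → c j ≡ 0ℚ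
  below (suc r) j rankⱼ<1+r with rank j ℕ.<? r
  ... | yes rankⱼ<r = below r j rankⱼ<r
  ... | no rankⱼ≮r = begin
    c j                                ≡⟨ sym (QP.*-identityʳ (c j)) ⟩
    c j * 1ℚ                           ≡⟨ cong (c j *_) (sym (diagonal j)) ⟩
    c j * (q j at σ j)                 ≡⟨ sym (sum-single (λ j′ → c j′ * (q j′ at σ j)) j others) ⟩
    sum (λ j′ → c j′ * (q j′ at σ j))  ≡⟨ c·q≡0 j ⟩
    0ℚ                                 ∎
    where
    open ≡-Reasoning
    rankⱼ≡r : rank j ≡ r
    rankⱼ≡r = NP.≤-antisym (NP.≤-pred rankⱼ<1+r) (NP.≮⇒≥ rankⱼ≮r)
    others : ∀ j′ → j′ ≢ j → c j′ * (q j′ at σ j) ≡ 0ℚ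
    others j′ j′≢j with rank j′ ℕ.<? r
    ... | yes rankⱼ′<r = *-vanishˡ (q j′ at σ j) (below r j′ rankⱼ′<r)
    ... | no rankⱼ′≮r  =
      *-vanishʳ (c j′) (off-diagonal j j′ j′≢j (subst (ℕ._≤ rank j′) (sym rankⱼ≡r) (NP.≮⇒≥ rankⱼ′≮r)))

affIndep-unitriangular :
  ∀ {n k D} {σ : Fin D → Coord n k} {rank : Fin D → ℕ} {q : Fin D → Point n k} →
  Unitriangular σ rank q → AffIndep (0ᵖ ∷ q)
affIndep-unitriangular {σ = σ} {q = q} tri c Σc≡0 Σcq≡0 = c≡0
  where
  open ≡-Reasoning
  tail-coordinate : ∀ x → sum (λ j → c (suc j) * (q j at x)) ≡ 0ℚ
  tail-coordinate x = begin
    rest                                    ≡⟨ sym (QP.+-identityˡ rest) ⟩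
    0ℚ + rest                               ≡⟨ cong (_+ rest) (sym (QP.*-zeroʳ (c zero))) ⟩
    c zero * 0ℚ + rest                      ≡⟨ sym (Σℚ≡sum (λ j → c j * ((0ᵖ ∷ q) j at x))) ⟩
    Σℚ (λ j → c j * ((0ᵖ ∷ q) j at x))      ≡⟨ Σcq≡0 (proj₁ x) (proj₂ x) ⟩
    0ℚ                                      ∎
    where
    rest : ℚ
    rest = sum (λ j → c (suc j) * (q j at x))
  c-tail≡0 : ∀ j → c (suc j) ≡ 0ℚ
  c-tail≡0 = linearIndependent-unitriangular tri (c ∘ suc) (tail-coordinate ∘ σ)
  c≡0 : ∀ j → c j ≡ 0ℚ
  c≡0 zero    = begin
    c zero       ≡⟨ sym (QP.+-identityʳ (c zero)) ⟩
    c zero + 0ℚ  ≡⟨ cong (c zero +_) (sym (sum-zero c-tail≡0)) ⟩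
    sum c        ≡⟨ sym (Σℚ≡sum c) ⟩
    Σℚ c         ≡⟨ Σc≡0 ⟩
    0ℚ           ∎
  c≡0 (suc j) = c-tail≡0 j

hasDim-unitriangular : ∀ {n k D} {σ : Fin D → Coord n k} {rank : Fin D → ℕ}
  (A : Point n k → Set) (q : Fin D → Point n k) → Unitriangular σ rank q →
  A 0ᵖ → (∀ j → A (q j)) → SupportedOn σ A → HasDim A D
hasDim-unitriangular A q tri A0 Aq supp =
  (0ᵖ ∷ q , (λ { zero → A0 ; (suc j) → Aq j }) , affIndep-unitriangular tri) ,
  ¬affIndep-supportedOn supp NP.≤-refl

count : ∀ {m} → (Fin m → Bool) → ℕ
count f = Σℕ (λ j → b2ℕ (f j))

AtMostOne : ∀ {m} → (Fin m → Bool) → Set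
AtMostOne f = ∀ a b → f a ≡ true → f b ≡ true → a ≡ b

count-none : ∀ {m} {f : Fin m → Bool} → (∀ j → f j ≢ true) → count f ≡ 0
count-none {zero}      _     = refl
count-none {suc m} {f} ∄true rewrite ¬-not (∄true zero) = count-none (∄true ∘ suc)

count-atMostOne : ∀ {m} {f : Fin m → Bool} → AtMostOne f → count f ℕ.≤ 1
count-atMostOne {zero}      _    = z≤n
count-atMostOne {suc m} {f} uniq with f zero in f₀
... | true  rewrite count-none {f = f ∘ suc} (λ j fⱼ → FP.0≢1+n (uniq zero (suc j) f₀ fⱼ)) = s≤s z≤n
... | false = count-atMostOne (λ a b fa fb → FP.suc-injective (uniq (suc a) (suc b) fa fb))

count-witness : ∀ {m} {f : Fin m → Bool} (j : Fin m) → f j ≡ true → 1 ℕ.≤ count f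
count-witness         zero    fⱼ rewrite fⱼ = s≤s z≤n
count-witness {f = f} (suc j) fⱼ = NP.≤-trans (count-witness j fⱼ) (NP.m≤n+m _ (b2ℕ (f zero)))

count-mono : ∀ {m m′} {f : Fin m → Bool} {g : Fin m′ → Bool} → AtMostOne f →
  (∀ a → f a ≡ true → ∃ λ b → g b ≡ true) → count f ℕ.≤ count g
count-mono {f = f} {g} uniq occupied with FP.any? (λ a → f a Bool.≟ true)
... | yes (a , fa) = NP.≤-trans (count-atMostOne uniq) (count-witness {f = g} _ (proj₂ (occupied a fa)))
... | no ∄a        = subst (ℕ._≤ count g) (sym (count-none {f = f} (λ a fa → ∄a (a , fa)))) z≤n

atMostOne-pair : ∀ {m} {f : Fin m → Bool} → AtMostOne f →
  ∀ {a b} → a ≢ b → b2ℕ (f a) ℕ.+ b2ℕ (f b) ℕ.≤ 1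
atMostOne-pair {f = f} uniq {a} {b} a≢b with f a in fa | f b in fb
... | true  | true  = contradiction (uniq a b fa fb) a≢b
... | true  | false = s≤s z≤n
... | false | true  = s≤s z≤n
... | false | false = z≤n

feasible-sparse : ∀ {n k} (G : Graph n) {x : BinPoint n k} →
  (∀ j → AtMostOne (λ v → x v j)) → (∀ v → AtMostOne (x v)) →
  (∀ j j′ → toℕ j′ ≡ suc (toℕ j) → ∀ v → x v j ≡ true → ∃ λ w → x w j′ ≡ true) →
  Feasible G k x
feasible-sparse G one-per-colour one-per-vertex upward =
  (λ j j′ j′≡1+j → count-mono (one-per-colour j) (upward j j′ j′≡1+j)) ,
  (λ v → count-atMostOne (one-per-vertex v)) ,
  (λ u v u≢v _ _ _ j → NP.≤-trans (atMostOne-pair (one-per-colour j) u≢v) (NP.m≤m+n 1 _))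

feasible-empty : ∀ {n k} (G : Graph n) → Feasible G k (λ _ _ → false)
feasible-empty G = feasible-sparse G (λ _ _ _ ()) (λ _ _ _ ()) (λ _ _ _ _ ())

inPk-feasible : ∀ {n k} (G : Graph n) (x : BinPoint n k) → Feasible G k x → InPk G k (embed x)
inPk-feasible G x feas =
  1 , (λ _ → x) , (λ _ → 1ℚ) , (λ _ → feas) , (λ _ → QP.nonNegative⁻¹ 1ℚ) , QP.+-identityʳ 1ℚ ,
  λ v i → sym (trans (QP.+-identityʳ _) (QP.*-identityˡ _))

Σℚ-nonneg : ∀ {m} (f : Fin m → ℚ) → (∀ j → 0ℚ ℚ.≤ f j) → 0ℚ ℚ.≤ Σℚ f
Σℚ-nonneg {zero}  f f≥0 = QP.≤-refl
Σℚ-nonneg {suc m} f f≥0 = QP.+-mono-≤ (f≥0 zero) (Σℚ-nonneg (f ∘ suc) (f≥0 ∘ suc))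

*-b2ℚ-nonneg : ∀ λ′ b → 0ℚ ℚ.≤ λ′ → 0ℚ ℚ.≤ λ′ ℚ.* b2ℚ b
*-b2ℚ-nonneg λ′ true  λ′≥0 = subst (0ℚ ℚ.≤_) (sym (QP.*-identityʳ λ′)) λ′≥0
*-b2ℚ-nonneg λ′ false _    = QP.≤-reflexive (sym (QP.*-zeroʳ λ′))

inPk-nonneg : ∀ {n k} (G : Graph n) (v : Fin n) (i : Fin k) → ∀ y → InPk G k y → 0ℚ ℚ.≤ y v i
inPk-nonneg G v i y (_ , p , λs , _ , λs≥0 , _ , y≡) =
  subst (0ℚ ℚ.≤_) (sym (y≡ v i)) (Σℚ-nonneg _ (λ j → *-b2ℚ-nonneg (λs j) (p j v i) (λs≥0 j)))

transpose-injective : ∀ {n} (a b : Fin n) → Injective _≡_ _≡_ (transpose a b)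
transpose-injective a b {x} {y} eq = begin
  x                                ≡⟨ sym (transpose-inverse b a) ⟩
  transpose b a (transpose a b x)  ≡⟨ cong (transpose b a) eq ⟩
  transpose b a (transpose a b y)  ≡⟨ transpose-inverse b a ⟩
  y                                ∎
  where open ≡-Reasoning

transpose-matchˡ : ∀ {n} (a b : Fin n) → transpose a b a ≡ b
transpose-matchˡ a b rewrite dec-true (a FP.≟ a) refl = refl

transpose-other : ∀ {n} {a b c : Fin n} → c ≢ a → c ≢ b → transpose a b c ≡ c
transpose-other {a = a} {b} {c} c≢a c≢b
  rewrite dec-false (c FP.≟ a) c≢a | dec-false (c FP.≟ b) c≢b = refl

does-true : ∀ {A : Set} (a? : Dec A) → does a? ≡ true → A
does-true (yes a) _ = a

module Staircase {n k} (e : Fin k → Fin n) (e-injective : Injective _≡_ _≡_ e) where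

  Marked : Coord n k → Fin n → Fin k → Set
  Marked (u , i) v j = i F.≤ j × transpose u (e i) v ≡ e j

  staircase : Coord n k → BinPoint n k
  staircase (u , i) v j = does (i F.≤? j ×-dec transpose u (e i) v FP.≟ e j)

  marked : ∀ c v j → staircase c v j ≡ true → Marked c v j
  marked (u , i) v j = does-true (i F.≤? j ×-dec transpose u (e i) v FP.≟ e j)

  staircase-marked : ∀ c v j → Marked c v j → staircase c v j ≡ true
  staircase-marked (u , i) v j = dec-true (i F.≤? j ×-dec transpose u (e i) v FP.≟ e j)

  staircase-unmarked : ∀ c v j → ¬ Marked c v j → staircase c v j ≡ false
  staircase-unmarked (u , i) v j = dec-false (i F.≤? j ×-dec transpose u (e i) v FP.≟ e j)

  staircase-feasible : ∀ (G : Graph n) c → Feasible G k (staircase c)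
  staircase-feasible G c@(u , i) = feasible-sparse G one-per-colour one-per-vertex upward
    where
    one-per-colour : ∀ j → AtMostOne (λ v → staircase c v j)
    one-per-colour j v v′ s s′ =
      transpose-injective u (e i) (trans (proj₂ (marked c v j s)) (sym (proj₂ (marked c v′ j s′))))
    one-per-vertex : ∀ v → AtMostOne (staircase c v)
    one-per-vertex v j j′ s s′ =
      e-injective (trans (sym (proj₂ (marked c v j s))) (proj₂ (marked c v j′ s′)))
    upward : ∀ j j′ → toℕ j′ ≡ suc (toℕ j) →
      ∀ v → staircase c v j ≡ true → ∃ λ w → staircase c w j′ ≡ true
    upward j j′ j′≡1+j v s = transpose (e i) u (e j′) , staircase-marked c (transpose (e i) u (e j′)) j′
      (NP.≤-trans (proj₁ (marked c v j s)) (subst (toℕ j ℕ.≤_) (sym j′≡1+j) (NP.n≤1+n (toℕ j))) ,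
       transpose-inverse u (e i))

  marked-diagonal : ∀ c → Marked c (proj₁ c) (proj₂ c)
  marked-diagonal (u , i) = NP.≤-refl , transpose-matchˡ u (e i)

  unmarked-above : ∀ {c c′} → toℕ (proj₂ c) ℕ.≤ toℕ (proj₂ c′) → c′ ≢ c →
    ¬ Marked c′ (proj₁ c) (proj₂ c)
  unmarked-above {u , i} {u′ , i′} i≤i′ c′≢c (i′≤i , τu≡ei) = c′≢c (cong₂ _,_ u′≡u (sym i≡i′))
    where
    i≡i′ : i ≡ i′
    i≡i′ = FP.toℕ-injective (NP.≤-antisym i≤i′ i′≤i)
    u′≡u : u′ ≡ u
    u′≡u = transpose-injective u′ (e i′)
      (trans (transpose-matchˡ u′ (e i′)) (trans (cong e (sym i≡i′)) (sym τu≡ei)))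

  unmarked-avoided : ∀ {c c₀} → (∀ j → e j ≢ proj₁ c₀) → c ≢ c₀ → ¬ Marked c (proj₁ c₀) (proj₂ c₀)
  unmarked-avoided {u , i} {v₀ , i₀} avoids c≢c₀ m@(_ , τv₀≡ei₀) with i FP.≟ i₀
  ... | yes i≡i₀ = unmarked-above (NP.≤-reflexive (cong toℕ (sym i≡i₀))) c≢c₀ m
  ... | no i≢i₀  = lower-colour (v₀ FP.≟ u)
    where
    lower-colour : Dec (v₀ ≡ u) → ⊥
    lower-colour (yes v₀≡u) = i≢i₀ (e-injective (begin
      e i                   ≡⟨ sym (transpose-matchˡ u (e i)) ⟩
      transpose u (e i) u   ≡⟨ cong (transpose u (e i)) (sym v₀≡u) ⟩
      transpose u (e i) v₀  ≡⟨ τv₀≡ei₀ ⟩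
      e i₀                  ∎))
      where open ≡-Reasoning
    lower-colour (no v₀≢u) = avoids i₀ (sym (trans (sym (transpose-other v₀≢u (avoids i ∘ sym))) τv₀≡ei₀))

  staircase-unitriangular : ∀ {D} (σ : Fin D → Coord n k) → Injective _≡_ _≡_ σ →
    Unitriangular σ (toℕ ∘ proj₂ ∘ σ) (embed ∘ staircase ∘ σ)
  staircase-unitriangular σ σ-injective = record
    { diagonal     = λ j →
        cong b2ℚ (staircase-marked (σ j) (proj₁ (σ j)) (proj₂ (σ j)) (marked-diagonal (σ j)))
    ; off-diagonal = λ j j′ j′≢j rank≤ → cong b2ℚ
        (staircase-unmarked (σ j′) (proj₁ (σ j)) (proj₂ (σ j)) (unmarked-above rank≤ (j′≢j ∘ σ-injective)))
    }

loopless : ∀ {n} (G : Graph n) {u v} → adj G u v ≡ true → u ≢ v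
loopless G {u} uv refl with trans (sym uv) (irr G u)
... | ()

matching⇒< : ∀ {n k} (G : Graph n) → HasMatching G (suc k) → suc k ℕ.< n
matching⇒< G (a , b , edge , disjoint) = FP.injective⇒≤ {f = b zero ∷ a} injective
  where
  a≢b₀ : ∀ j → a j ≢ b zero
  a≢b₀ j with j FP.≟ zero
  ... | yes refl = loopless G (edge zero)
  ... | no j≢0   = proj₁ (proj₂ (disjoint j zero j≢0))
  injective : Injective _≡_ _≡_ (b zero ∷ a)
  injective {zero}  {zero}   _     = refl
  injective {zero}  {suc j}  b₀≡aⱼ = contradiction (sym b₀≡aⱼ) (a≢b₀ j)
  injective {suc j} {zero}   aⱼ≡b₀ = contradiction aⱼ≡b₀ (a≢b₀ j)
  injective {suc j} {suc j′} aⱼ≡aⱼ′ with j FP.≟ j′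
  ... | yes j≡j′ = cong suc j≡j′
  ... | no j≢j′  = contradiction aⱼ≡aⱼ′ (proj₁ (disjoint j j′ j≢j′))

injection-avoiding : ∀ {k n} → k ℕ.< n → (v₀ : Fin n) →
  ∃ λ (e : Fin k → Fin n) → Injective _≡_ _≡_ e × (∀ j → e j ≢ v₀)
injection-avoiding {n = suc n} (s≤s k≤n) v₀ =
  (λ j → punchIn v₀ (F.inject≤ j k≤n)) ,
  (λ eq → FP.inject≤-injective k≤n k≤n _ _ (FP.punchIn-injective v₀ _ _ eq)) ,
  (λ j → FP.punchInᵢ≢i v₀ _)

module Dimensions {n k} (G : Graph (suc n))
  (e : Fin (suc k) → Fin (suc n)) (e-injective : Injective _≡_ _≡_ e) where
  open Staircase e e-injective

  σ : Fin (suc n ℕ.* suc k) → Coord (suc n) (suc k)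
  σ = F.remQuot {suc n} (suc k)

  origin : InPk G (suc k) 0ᵖ
  origin = inPk-feasible G (λ _ _ → false) (feasible-empty G)

  vertex : ∀ c → InPk G (suc k) (embed (staircase c))
  vertex c = inPk-feasible G (staircase c) (staircase-feasible G c)

  dim-Pk : HasDim (InPk G (suc k)) (suc n ℕ.* suc k)
  dim-Pk = hasDim-unitriangular (InPk G (suc k)) (embed ∘ staircase ∘ σ)
    (staircase-unitriangular σ (remQuot-injective (suc k))) origin (vertex ∘ σ) supportedOn-remQuot

  module _ (v₀ : Fin (suc n)) (i₀ : Fin (suc k)) (avoids : ∀ j → e j ≢ v₀) where
    Face : Point (suc n) (suc k) → Set
    Face y = InPk G (suc k) y × (y v₀ i₀ ≡ 0ℚ)

    p : Fin (suc n ℕ.* suc k)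
    p = F.combine v₀ i₀

    σ′ : Fin (ℕ.pred (suc n ℕ.* suc k)) → Coord (suc n) (suc k)
    σ′ = σ ∘ punchIn p

    σ′≢c₀ : ∀ j → σ′ j ≢ (v₀ , i₀)
    σ′≢c₀ j eq =
      FP.punchInᵢ≢i p j (remQuot-injective (suc k) (trans eq (sym (FP.remQuot-combine v₀ i₀))))

    face-vertex : ∀ j → Face (embed (staircase (σ′ j)))
    face-vertex j =
      vertex (σ′ j) , cong b2ℚ (staircase-unmarked (σ′ j) v₀ i₀ (unmarked-avoided avoids (σ′≢c₀ j)))

    dim-face : HasDim Face (ℕ.pred (suc n ℕ.* suc k))
    dim-face = hasDim-unitriangular Face (embed ∘ staircase ∘ σ′)
      (staircase-unitriangular σ′ (FP.punchIn-injective p _ _ ∘ remQuot-injective (suc k)))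
      (origin , refl) face-vertex
      (supportedOn-removeAt p supportedOn-remQuot
        (λ y face-y → trans (cong (y at_) (FP.remQuot-combine v₀ i₀)) (proj₂ face-y)))

mainTheorem5 : (k n : ℕ) → k ≥ 1 → (G : Graph n) → Connected G → HasMatching G k →
    (v : Fin n) (i : Fin k) → InducesFacet (InPk G k) (λ y → y v i)
mainTheorem5 (suc k) (suc n) _ G _ matching v₀ i₀
  with injection-avoiding (matching⇒< G matching) v₀
... | e , e-injective , avoids = inPk-nonneg G v₀ i₀ , inj₁ (_ , dim-Pk , dim-face v₀ i₀ avoids)
  where open Dimensions G e e-injective
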